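{- Let $u$ and $v$ be $n$-dimensional integral column vectors and let $p$ be an odd prime. Suppose that (i) $u\not\equiv 0\pmod p$ and $v\not\equiv 0\pmod p$; (ii) $u$ and $v$ are linearly dependent over $\mathbb{F}_p$ (after reduction modulo $p$); (iii) $u^Tu=v^Tv\equiv 0\pmod{p^2}$. Then $u^Tv\equiv 0\pmod{p^2}$. -}

module Defs where

open import Data.Nat using (ℕ)
open import Data.Integer using (ℤ; _+_; _*_; +_)
open import Data.Integer.Divisibility using (_∣_)
open import Data.Vec using (Vec; []; _∷_; zipWith; map)
open import Data.Vec.Relation.Unary.All using (All)
open import Data.Product using (∃₂; _×_)
open import Data.Sum using (_⊎_)
open import Relation.Nullary using (¬_)

dot : ∀ {n} → Vec ℤ n → Vec ℤ n → ℤ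
dot [] [] = + 0
dot (x ∷ xs) (y ∷ ys) = x * y + dot xs ys

VecZeroMod : ∀ {n} → ℤ → Vec ℤ n → Set
VecZeroMod m u = All (m ∣_) u

lincomb : ∀ {n} → ℤ → Vec ℤ n → ℤ → Vec ℤ n → Vec ℤ n
lincomb a u b v = zipWith _+_ (map (a *_) u) (map (b *_) v)

-- u, v linearly dependent over F_p after reduction mod p:
-- there are scalars a, b, not both ≡ 0 (mod p), with a·u + b·v ≡ 0 (mod p)
LinDepMod : ∀ {n} → ℤ → Vec ℤ n → Vec ℤ n → Set
LinDepMod p u v = ∃₂ λ a b → (¬ (p ∣ a) ⊎ ¬ (p ∣ b)) × VecZeroMod p (lincomb a u b v)

{-# OPTIONS --safe #-}
module Submission where

-- Writing w = a·u + b·v, the dependence gives w ≡ 0 (mod p), hence p² ∣ wᵀw. Since u and v are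
-- nonzero mod p, neither a nor b is divisible by p. Expanding,
--   wᵀw = a²·uᵀu + 2ab·uᵀv + b²·vᵀv,
-- and p² divides the two outer terms, so p² ∣ 2ab·uᵀv; as p is odd, p ∤ 2ab and p² ∣ uᵀv.

open import Defs
open import Data.Nat using (ℕ; suc; s≤s; z≤n) renaming (_*_ to _*ℕ_)
open import Data.Nat.Divisibility as ℕ using ()
open import Data.Nat.Primality using (Prime; euclidsLemma; ¬prime[0]; ¬prime[1]; prime⇒nonZero)
open import Data.Integer using (ℤ; +_; _*_; _+_; ∣_∣)
open import Data.Integer.Divisibility using (_∣_)
import Data.Integer.Divisibility.Signed as Signed
-- Signed divisibility is a record, so unlike the unsigned _∣_ (divisibility of absolute
-- values in ℕ) its indices can be inferred; the argument works with it throughout.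
open Signed using () renaming (_∣_ to _∣ˢ_)
open import Data.Nat.Properties using () renaming (*-assoc to *ℕ-assoc)
open import Data.Integer.Properties using (abs-*; +-comm)
open import Data.Integer.Tactic.RingSolver using (solve; solve-∀)
import Data.List as List using (_∷_; [])
open import Data.Vec using (Vec; []; _∷_; map)
open import Data.Vec.Properties using (zipWith-comm)
open import Data.Vec.Relation.Unary.All using ([]; _∷_)
open import Data.Product using (_×_; _,_; proj₁; proj₂)
open import Data.Sum as Sum using (_⊎_; inj₁; inj₂)
open import Relation.Nullary using (¬_; contradiction)
open import Relation.Binary.PropositionalEquality
  using (_≡_; refl; sym; cong; subst; subst₂; module ≡-Reasoning)
open import Function using (_∘_)

module Nat where

  odd-prime∤2 : ∀ {p} → Prime p → ¬ (2 ℕ.∣ p) → ¬ (p ℕ.∣ 2)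
  odd-prime∤2 {0} p-prime _   _   = ¬prime[0] p-prime
  odd-prime∤2 {1} p-prime _   _   = ¬prime[1] p-prime
  odd-prime∤2 {2} _       2∤p _   = 2∤p ℕ.∣-refl
  odd-prime∤2 {suc (suc (suc _))} _ _ = ℕ.>⇒∤ (s≤s (s≤s (s≤s z≤n)))

  prime∣*-cancelˡ : ∀ {p m n} → Prime p → ¬ p ℕ.∣ m → p ℕ.∣ m *ℕ n → p ℕ.∣ n
  prime∣*-cancelˡ {m = m} {n} p-prime p∤m p∣mn with euclidsLemma m n p-prime p∣mn
  ... | inj₁ p∣m = contradiction p∣m p∤m
  ... | inj₂ p∣n = p∣n

  prime²∣*-cancelˡ : ∀ {p m n} → Prime p → ¬ p ℕ.∣ m → p *ℕ p ℕ.∣ m *ℕ n → p *ℕ p ℕ.∣ n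
  prime²∣*-cancelˡ {p} {m} {n} p-prime p∤m p²∣mn
    with prime∣*-cancelˡ p-prime p∤m (ℕ.∣-trans (ℕ.m∣m*n p) p²∣mn)
  ... | ℕ.divides q refl = ℕ.*-monoˡ-∣ p (prime∣*-cancelˡ p-prime p∤m p∣mq)
    where
    instance _ = prime⇒nonZero p-prime
    p∣mq : p ℕ.∣ m *ℕ q
    p∣mq = ℕ.*-cancelʳ-∣ p (subst (p *ℕ p ℕ.∣_) (sym (*ℕ-assoc m q p)) p²∣mn)

module Int where

  *-pres-∣ : ∀ {k l i j} → k ∣ˢ i → l ∣ˢ j → k * l ∣ˢ i * j
  *-pres-∣ {l = l} {i} k∣i l∣j = Signed.∣-trans (Signed.*-monoˡ-∣ l k∣i) (Signed.*-monoʳ-∣ i l∣j)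

  prime∣*-cancelˡ : ∀ {p i j} → Prime p → ¬ + p ∣ˢ i → + p ∣ˢ i * j → + p ∣ˢ j
  prime∣*-cancelˡ {p} {i} {j} p-prime p∤i =
    Signed.∣ᵤ⇒∣
    ∘ Nat.prime∣*-cancelˡ p-prime (p∤i ∘ Signed.∣ᵤ⇒∣)
    ∘ subst (p ℕ.∣_) (abs-* i j)
    ∘ Signed.∣⇒∣ᵤ

  prime∤* : ∀ {p i j} → Prime p → ¬ + p ∣ˢ i → ¬ + p ∣ˢ j → ¬ + p ∣ˢ i * j
  prime∤* p-prime p∤i p∤j = p∤j ∘ prime∣*-cancelˡ p-prime p∤i

  prime²∣*-cancelˡ : ∀ {p i j} → Prime p → ¬ + p ∣ˢ i → + p * + p ∣ˢ i * j → + p * + p ∣ˢ j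
  prime²∣*-cancelˡ {p} {i} {j} p-prime p∤i =
    Signed.∣ᵤ⇒∣
    ∘ subst (ℕ._∣ ∣ j ∣) (sym (abs-* (+ p) (+ p)))
    ∘ Nat.prime²∣*-cancelˡ p-prime (p∤i ∘ Signed.∣ᵤ⇒∣)
    ∘ subst₂ ℕ._∣_ (abs-* (+ p) (+ p)) (abs-* i j)
    ∘ Signed.∣⇒∣ᵤ

dot-self-lincomb : ∀ {n} a b (u v : Vec ℤ n) →
  dot (lincomb a u b v) (lincomb a u b v)
    ≡ a * a * dot u u + + 2 * a * b * dot u v + b * b * dot v v
dot-self-lincomb a b [] [] = solve (a List.∷ b List.∷ List.[])
dot-self-lincomb a b (x ∷ u) (y ∷ v) = begin
  (a * x + b * y) * (a * x + b * y) + dot (lincomb a u b v) (lincomb a u b v)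
    ≡⟨ cong (_+_ ((a * x + b * y) * (a * x + b * y))) (dot-self-lincomb a b u v) ⟩
  (a * x + b * y) * (a * x + b * y) + (a * a * U + + 2 * a * b * W + b * b * V)
    ≡⟨ expand a b x y U W V ⟩
  a * a * (x * x + U) + + 2 * a * b * (x * y + W) + b * b * (y * y + V) ∎
  where
  open ≡-Reasoning
  U = dot u u
  W = dot u v
  V = dot v v
  expand : ∀ a b x y U W V →
    (a * x + b * y) * (a * x + b * y) + (a * a * U + + 2 * a * b * W + b * b * V)
      ≡ a * a * (x * x + U) + + 2 * a * b * (x * y + W) + b * b * (y * y + V)
  expand = solve-∀

VecZeroMod⇒²∣dot-self : ∀ {n k} {u : Vec ℤ n} → VecZeroMod k u → k * k ∣ˢ dot u u
VecZeroMod⇒²∣dot-self []          = Signed.∣ᵤ⇒∣ (ℕ._∣0 _)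
VecZeroMod⇒²∣dot-self {k = k} {x ∷ _} (k∣x ∷ k∣u) =
  Signed.∣m∣n⇒∣m+n (Int.*-pres-∣ k∣ˢx k∣ˢx) (VecZeroMod⇒²∣dot-self {k = k} k∣u)
  where k∣ˢx = Signed.∣ᵤ⇒∣ {k} {x} k∣x

VecZeroMod-lincomb-cancelˡ : ∀ {n p a b} → Prime p → ¬ + p ∣ˢ a → + p ∣ˢ b → (u v : Vec ℤ n)
  → VecZeroMod (+ p) (lincomb a u b v) → VecZeroMod (+ p) u
VecZeroMod-lincomb-cancelˡ _ _ _ [] [] [] = []
VecZeroMod-lincomb-cancelˡ {p = p} {a} {b} p-prime p∤a p∣b (x ∷ u) (y ∷ v) (p∣ax+by ∷ p∣w) =
  Signed.∣⇒∣ᵤ (Int.prime∣*-cancelˡ p-prime p∤a p∣ax)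
  ∷ VecZeroMod-lincomb-cancelˡ p-prime p∤a p∣b u v p∣w
  where
  p∣ax : + p ∣ˢ a * x
  p∣ax = Signed.∣m+n∣n⇒∣m (Signed.∣ᵤ⇒∣ {+ p} {a * x + b * y} p∣ax+by) (Signed.∣m⇒∣m*n y p∣b)

lincomb-comm : ∀ {n} a (u : Vec ℤ n) b v → lincomb a u b v ≡ lincomb b v a u
lincomb-comm a u b v = zipWith-comm +-comm (map (a *_) u) (map (b *_) v)

LinDepMod-coefficients-nonzero : ∀ {n p a b} {u v : Vec ℤ n} → Prime p
  → ¬ VecZeroMod (+ p) u → ¬ VecZeroMod (+ p) v
  → ¬ + p ∣ˢ a ⊎ ¬ + p ∣ˢ b → VecZeroMod (+ p) (lincomb a u b v)
  → ¬ + p ∣ˢ a × ¬ + p ∣ˢ b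
LinDepMod-coefficients-nonzero {u = u} {v} p-prime u≢0 v≢0 (inj₁ p∤a) w≡0 =
  p∤a , λ p∣b → u≢0 (VecZeroMod-lincomb-cancelˡ p-prime p∤a p∣b u v w≡0)
LinDepMod-coefficients-nonzero {p = p} {a} {b} {u} {v} p-prime u≢0 v≢0 (inj₂ p∤b) w≡0 =
  (λ p∣a → v≢0 (VecZeroMod-lincomb-cancelˡ p-prime p∤b p∣a v u
                  (subst (VecZeroMod (+ p)) (lincomb-comm a u b v) w≡0)))
  , p∤b

lemma9 : (n p : ℕ) → Prime p → ¬ (2 ℕ.∣ p) → (u v : Vec ℤ n)
    → ¬ VecZeroMod (+ p) u → ¬ VecZeroMod (+ p) v
    → LinDepMod (+ p) u v
    → dot u u ≡ dot v v → (+ p * + p) ∣ dot u u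
    → (+ p * + p) ∣ dot u v
lemma9 _ p p-prime 2∤p u v u≢0 v≢0 (a , b , p∤a⊎p∤b , w≡0) uu≡vv p²∣uu =
  Signed.∣⇒∣ᵤ (Int.prime²∣*-cancelˡ p-prime p∤2ab p²∣2ab·uv)
  where
  p∤a×p∤b : ¬ + p ∣ˢ a × ¬ + p ∣ˢ b
  p∤a×p∤b = LinDepMod-coefficients-nonzero p-prime u≢0 v≢0
    (Sum.map (_∘ Signed.∣⇒∣ᵤ) (_∘ Signed.∣⇒∣ᵤ) p∤a⊎p∤b) w≡0

  p∤2ab : ¬ + p ∣ˢ + 2 * a * b
  p∤2ab = Int.prime∤* {i = + 2 * a} p-prime
    (Int.prime∤* {i = + 2} p-prime (Nat.odd-prime∤2 p-prime 2∤p ∘ Signed.∣⇒∣ᵤ) (proj₁ p∤a×p∤b))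
    (proj₂ p∤a×p∤b)

  p²∣uu′ : + p * + p ∣ˢ dot u u
  p²∣uu′ = Signed.∣ᵤ⇒∣ {+ p * + p} {dot u u} p²∣uu

  p²∣ww : + p * + p ∣ˢ a * a * dot u u + + 2 * a * b * dot u v + b * b * dot v v
  p²∣ww = subst (+ p * + p ∣ˢ_) (dot-self-lincomb a b u v)
    (VecZeroMod⇒²∣dot-self {k = + p} w≡0)

  p²∣2ab·uv : + p * + p ∣ˢ + 2 * a * b * dot u v
  p²∣2ab·uv = Signed.∣m+n∣m⇒∣n
    (Signed.∣m+n∣n⇒∣m p²∣ww (Signed.∣n⇒∣m*n (b * b) (subst (+ p * + p ∣ˢ_) uu≡vv p²∣uu′)))
    (Signed.∣n⇒∣m*n (a * a) p²∣uu′)
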